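{- Let $F=(F_n)$ be a linear-like semiring family of graphs. Then for all finite graphs $G,H$, $\eta_F(G+H)=\eta_F(G)+\eta_F(H)$ and $\eta_{F,f}(G+H)=\eta_{F,f}(G)+\eta_{F,f}(H)$.
   Context: Graphs are undirected simple graphs, possibly infinite; $X\to Y$ denotes existence of a graph homomorphism; $\omega$ is the clique number. The join $G+H$ is the disjoint union with all edges between the two parts added; the disjunctive product $G\ast H$ has vertex set $V(G)\times V(H)$ with $(v,w)\sim(v',w')$ iff $v\sim v'$ or $w\sim w'$. For $d\in\mathbb{N}_+$, $G/d$ is the graph of $d$-cliques of $G$, with $S\sim T$ iff $S\cap T=\emptyset$ and $s\sim t$ for all $s\in S,t\in T$. A semiring family is a sequence $(F_n)_{n\in\mathbb{N}}$ with $F_0=\emptyset$, $F_1\ne\emptyset$, $F_n+F_m\to F_{n+m}$, $F_n\ast F_m\to F_{nm}$. For $S\subseteq V(G)$, $S^\perp$ is the set of vertices adjacent to all vertices of $S$; $S$ is a flat if $S^{\perp\perp}=S$; $\mathrm{rk}(S)=\omega(S^{\perp\perp})$. $(F_n)$ is linear-like if for every $n$ and every flat $S\subseteq V(F_n)$, the induced subgraph on $S$ is homomorphically equivalent to $F_{\mathrm{rk}(S)}$. For finite $G$: $\eta_F(G)=\min\{n\in\mathbb{N}: G\to F_n\}$ and $\eta_{F,f}(G)=\inf\{n/d: n\in\mathbb{N},d\in\mathbb{N}_+, G\to F_n/d\}$. -}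

module Defs where

open import Data.Nat using (ℕ; zero; suc; _+_; _*_; _≤_; NonZero)
open import Data.Fin using (Fin)
import Data.Fin as Fin
open import Data.Product using (Σ; ∃; _×_; _,_; proj₁; proj₂)
open import Data.Sum using (_⊎_; inj₁; inj₂)
open import Data.Unit using (⊤; tt)
open import Data.Empty using (⊥)
open import Relation.Nullary using (¬_)
open import Relation.Binary.PropositionalEquality using (_≡_; _≢_)
open import Function.Bundles using (_↔_)
open import Data.Integer using (+_)
open import Data.Rational using (ℚ; _<_) renaming (_/_ to _/ℚ_; _+_ to _+ℚ_)

record Graph : Set₁ where
  field
    V     : Set
    _~_   : V → V → Set
    sym~  : ∀ {x y} → x ~ y → y ~ x
    irr~  : ∀ {x} → ¬ (x ~ x)
open Graph public

Finite : Graph → Set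
Finite G = Σ ℕ λ k → V G ↔ Fin k

_⇒_ : Graph → Graph → Set
G ⇒ H = Σ (V G → V H) λ f → ∀ {x y} → _~_ G x y → _~_ H (f x) (f y)

_≃ₕ_ : Graph → Graph → Set
G ≃ₕ H = (G ⇒ H) × (H ⇒ G)

joinAdj : (G H : Graph) → V G ⊎ V H → V G ⊎ V H → Set
joinAdj G H (inj₁ x) (inj₁ y) = _~_ G x y
joinAdj G H (inj₁ x) (inj₂ y) = ⊤
joinAdj G H (inj₂ x) (inj₁ y) = ⊤
joinAdj G H (inj₂ x) (inj₂ y) = _~_ H x y

joinSym : (G H : Graph) → ∀ {x y} → joinAdj G H x y → joinAdj G H y x
joinSym G H {inj₁ x} {inj₁ y} e = sym~ G e
joinSym G H {inj₁ x} {inj₂ y} e = tt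
joinSym G H {inj₂ x} {inj₁ y} e = tt
joinSym G H {inj₂ x} {inj₂ y} e = sym~ H e

joinIrr : (G H : Graph) → ∀ {x} → ¬ joinAdj G H x x
joinIrr G H {inj₁ x} e = irr~ G e
joinIrr G H {inj₂ x} e = irr~ H e

infixl 6 _⊕_
_⊕_ : Graph → Graph → Graph
G ⊕ H = record
  { V = V G ⊎ V H ; _~_ = joinAdj G H
  ; sym~ = λ {x} {y} → joinSym G H {x} {y} ; irr~ = λ {x} → joinIrr G H {x} }

prodIrr : (G H : Graph) → ∀ {x} →
          ¬ ((_~_ G (proj₁ x) (proj₁ x)) ⊎ (_~_ H (proj₂ x) (proj₂ x)))
prodIrr G H (inj₁ e) = irr~ G e
prodIrr G H (inj₂ e) = irr~ H e

infixl 7 _⊛_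
_⊛_ : Graph → Graph → Graph
G ⊛ H = record
  { V = V G × V H
  ; _~_ = λ x y → (_~_ G (proj₁ x) (proj₁ y)) ⊎ (_~_ H (proj₂ x) (proj₂ y))
  ; sym~ = λ { (inj₁ e) → inj₁ (sym~ G e) ; (inj₂ e) → inj₂ (sym~ H e) }
  ; irr~ = prodIrr G H }

-- Cliques and the clique graph G / d.
-- A d-clique is represented by an enumeration Fin d → V G whose entries
-- are pairwise adjacent (hence pairwise distinct).

IsClique : (G : Graph) (d : ℕ) → (Fin d → V G) → Set
IsClique G d c = ∀ i j → i ≢ j → _~_ G (c i) (c j)

Clique : Graph → ℕ → Set
Clique G d = Σ (Fin d → V G) (IsClique G d)

-- S ∼ T iff S ∩ T = ∅ and every s ∈ S is adjacent to every t ∈ T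
-- (disjointness follows from irreflexivity, but we state it as the paper does).
cliqueAdj : (G : Graph) (d : ℕ) → Clique G d → Clique G d → Set
cliqueAdj G d S T =
  (∀ i j → proj₁ S i ≢ proj₁ T j) × (∀ i j → _~_ G (proj₁ S i) (proj₁ T j))

cliqueIrr : (G : Graph) (d : ℕ) → .{{_ : NonZero d}} → ∀ {S} → ¬ cliqueAdj G d S S
cliqueIrr G (suc d) (disj , _) = disj Fin.zero Fin.zero _≡_.refl

infixl 7 _/_
_/_ : Graph → (d : ℕ) → .{{_ : NonZero d}} → Graph
G / d = record
  { V = Clique G d
  ; _~_ = cliqueAdj G d
  ; sym~ = λ { (disj , adj) →
               (λ i j e → disj j i (Relation.Binary.PropositionalEquality.sym e))
             , (λ i j → sym~ G (adj j i)) }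
  ; irr~ = λ {S} → cliqueIrr G d {S} }

record SemiringFamily (F : ℕ → Graph) : Set where
  field
    empty0 : ¬ V (F 0)
    inhab1 : V (F 1)
    addHom : ∀ n m → (F n ⊕ F m) ⇒ F (n + m)
    mulHom : ∀ n m → (F n ⊛ F m) ⇒ F (n * m)

Subset : Graph → Set₁
Subset G = V G → Set

perp : (G : Graph) → Subset G → Subset G
perp G S v = ∀ s → S s → _~_ G s v

_≐_ : {G : Graph} → Subset G → Subset G → Set
_≐_ {G} S T = ∀ v → (S v → T v) × (T v → S v)

IsFlat : (G : Graph) → Subset G → Set
IsFlat G S = _≐_ {G} (perp G (perp G S)) S

Induced : (G : Graph) → Subset G → Graph
Induced G S = record
  { V = Σ (V G) S
  ; _~_ = λ x y → _~_ G (proj₁ x) (proj₁ y)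
  ; sym~ = λ {x} {y} → sym~ G {proj₁ x} {proj₁ y}
  ; irr~ = λ {x} → irr~ G {proj₁ x} }

CliqueIn : (G : Graph) → Subset G → ℕ → Set
CliqueIn G S k = Σ (Clique G k) λ c → ∀ i → S (proj₁ c i)

IsCliqueNumber : (G : Graph) → Subset G → ℕ → Set
IsCliqueNumber G S r = CliqueIn G S r × (∀ k → CliqueIn G S k → k ≤ r)

IsRank : (G : Graph) → Subset G → ℕ → Set
IsRank G S r = IsCliqueNumber G (perp G (perp G S)) r

LinearLike : (ℕ → Graph) → Set₁
LinearLike F = ∀ n (S : Subset (F n)) → IsFlat (F n) S →
  Σ ℕ λ r → IsRank (F n) S r × (Induced (F n) S ≃ₕ F r)

IsEta : (ℕ → Graph) → Graph → ℕ → Set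
IsEta F G n = (G ⇒ F n) × (∀ m → G ⇒ F m → n ≤ m)

-- The set whose infimum is η_{F,f}(G): rationals n/d with d ≥ 1 and G → F n / d.
FracVal : (ℕ → Graph) → Graph → ℚ → Set
FracVal F G q = Σ ℕ λ n → Σ ℕ λ d → (G ⇒ (F n / suc d)) × (q ≡ (+ n) /ℚ (suc d))

-- Open upper cut of the infimum: r > η_{F,f}(G) iff some element of the set is < r.
AboveFrac : (ℕ → Graph) → Graph → ℚ → Set
AboveFrac F G r = Σ ℚ λ q → FracVal F G q × q < r

-- r > η_{F,f}(G) + η_{F,f}(H) iff there are q₁, q₂ in the two sets with q₁ + q₂ < r.
AboveFracSum : (ℕ → Graph) → Graph → Graph → ℚ → Set
AboveFracSum F G H r =
  Σ ℚ λ q₁ → Σ ℚ λ q₂ → FracVal F G q₁ × FracVal F H q₂ × (q₁ +ℚ q₂) < r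

-- A homomorphism G + H → F_m / d splits along flats of F_m: if S is the set of vertices
-- used by the image of G, then G lands in the flat S⊥⊥ and H in the flat S⊥. By
-- linear-likeness these flats map to F_r₁ and F_r₂, and maximum cliques of the two flats
-- are joined to each other, so r₁ + r₂ ≤ ω(F_m) = m. This gives the lower bounds for both
-- η_F (take d = 1) and η_{F,f}. The upper bounds come from F_a + F_b → F_(a+b), after
-- bringing fractions to a common denominator through F_n / d → (F_n ∗ F_k) / dk → F_(nk) / dk.

module Submission where

open import Defs
open import Data.Nat using (ℕ; _+_)
open import Data.Product using (_×_)
open import Data.Rational using (ℚ)

open import Data.Empty using (⊥-elim)
open import Data.Fin using (Fin; zero; splitAt; remQuot)
import Data.Fin.Properties as Fin
open import Data.Integer using (+_; +≤+)
import Data.Integer as ℤ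
import Data.Integer.Properties as ℤ
open import Data.Nat using (suc; _*_; _∸_; _≤_; NonZero)
import Data.Nat.Properties as ℕ
open import Data.Product using (Σ; _,_; proj₁; proj₂)
import Data.Product as Product
open import Data.Rational using (fromℚᵘ)
import Data.Rational as ℚ
import Data.Rational.Properties as ℚ
open import Data.Rational.Unnormalised using (mkℚᵘ; *≤*)
import Data.Rational.Unnormalised as ℚᵘ
import Data.Rational.Unnormalised.Properties as ℚᵘ
open import Data.Sum using (_⊎_; inj₁; inj₂; [_,_])
import Data.Sum as Sum
open import Data.Unit using (tt)
open import Function using (_∘_)
open import Function.Bundles using (Injection)
open import Function.Definitions using (Injective)
open import Function.Properties.Inverse using (↔⇒↣)
open import Relation.Binary.Definitions using (DecidableEquality)
open import Relation.Binary.PropositionalEquality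
  using (_≡_; _≢_; refl; sym; trans; cong; cong₂; subst; subst₂)
open import Relation.Nullary using (yes; no)
open import Relation.Unary using (∅)

fromℚᵘ-homo-+ : ∀ p q → fromℚᵘ (p ℚᵘ.+ q) ≡ fromℚᵘ p ℚ.+ fromℚᵘ q
fromℚᵘ-homo-+ p q = trans
  (ℚ.fromℚᵘ-cong (ℚᵘ.≃-sym (ℚᵘ.≃-trans (ℚ.toℚᵘ-homo-+ (fromℚᵘ p) (fromℚᵘ q))
                                        (ℚᵘ.+-cong (ℚ.toℚᵘ-fromℚᵘ p) (ℚ.toℚᵘ-fromℚᵘ q)))))
  (ℚ.fromℚᵘ-toℚᵘ _)

fromℚᵘ-mono-≤ : ∀ {p q} → p ℚᵘ.≤ q → fromℚᵘ p ℚ.≤ fromℚᵘ q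
fromℚᵘ-mono-≤ {p} {q} p≤q = ℚ.toℚᵘ-cancel-≤
  (ℚᵘ.≤-respˡ-≃ (ℚᵘ.≃-sym (ℚ.toℚᵘ-fromℚᵘ p))
    (ℚᵘ.≤-respʳ-≃ (ℚᵘ.≃-sym (ℚ.toℚᵘ-fromℚᵘ q)) p≤q))

n/c+m/d≡[nd+mc]/cd : ∀ n c m d →
  + n ℚ./ suc c ℚ.+ + m ℚ./ suc d ≡ + (n * suc d + m * suc c) ℚ./ (suc c * suc d)
n/c+m/d≡[nd+mc]/cd n c m d = trans
  (sym (fromℚᵘ-homo-+ (mkℚᵘ (+ n) c) (mkℚᵘ (+ m) d)))
  (cong (λ k → fromℚᵘ (mkℚᵘ k (d + c * suc d)))
    (trans (cong₂ ℤ._+_ (sym (ℤ.pos-* n (suc d))) (sym (ℤ.pos-* m (suc c))))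
           (sym (ℤ.pos-+ (n * suc d) (m * suc c)))))

n/d+m/d≤k/d : ∀ n m {k} d → n + m ≤ k →
  + n ℚ./ suc d ℚ.+ + m ℚ./ suc d ℚ.≤ + k ℚ./ suc d
n/d+m/d≤k/d n m {k} d n+m≤k = begin
  + n ℚ./ D ℚ.+ + m ℚ./ D        ≡⟨ n/c+m/d≡[nd+mc]/cd n d m d ⟩
  + (n * D + m * D) ℚ./ (D * D)  ≤⟨ fromℚᵘ-mono-≤ {mkℚᵘ (+ (n * D + m * D)) (d + d * D)}
                                                    {mkℚᵘ (+ k) d}
                                      (*≤* (subst₂ ℤ._≤_ (ℤ.pos-* (n * D + m * D) D) (ℤ.pos-* k (D * D))
                                                       (+≤+ cross))) ⟩
  + k ℚ./ D                      ∎
  where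
  open ℚ.≤-Reasoning
  D = suc d
  cross : (n * D + m * D) * D ≤ k * (D * D)
  cross = subst₂ _≤_ (cong (_* D) (ℕ.*-distribʳ-+ D n m)) (ℕ.*-assoc k D D)
    (ℕ.*-monoˡ-≤ D (ℕ.*-monoˡ-≤ D n+m≤k))

adj⇒≢ : (X : Graph) {x y : V X} → _~_ X x y → x ≢ y
adj⇒≢ X x~x refl = irr~ X x~x

module ⇒-Reasoning where

  infix  1 begin_
  infixr 2 _⇒⟨_⟩_
  infix  3 _∎

  record _↝_ (X Y : Graph) : Set where
    constructor chain
    field hom : X ⇒ Y

  begin_ : {X Y : Graph} → X ↝ Y → X ⇒ Y
  begin chain f = f

  _⇒⟨_⟩_ : (X : Graph) {Y Z : Graph} → X ⇒ Y → Y ↝ Z → X ↝ Z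
  X ⇒⟨ f , f-hom ⟩ chain (g , g-hom) = chain ((λ x → g (f x)) , λ x~y → g-hom (f-hom x~y))

  _∎ : (X : Graph) → X ↝ X
  X ∎ = chain ((λ x → x) , λ x~y → x~y)

open ⇒-Reasoning

ι₁ : (G H : Graph) → G ⇒ (G ⊕ H)
ι₁ G H = inj₁ , λ x~y → x~y

ι₂ : (G H : Graph) → H ⇒ (G ⊕ H)
ι₂ G H = inj₂ , λ x~y → x~y

_⊕ₕ_ : {G G′ H H′ : Graph} → G ⇒ G′ → H ⇒ H′ → (G ⊕ H) ⇒ (G′ ⊕ H′)
_⊕ₕ_ {G} {G′} {H} {H′} (f , f-hom) (g , g-hom) = Sum.map f g , λ {u} {v} → hom u v
  where
  hom : ∀ u v → joinAdj G H u v → joinAdj G′ H′ (Sum.map f g u) (Sum.map f g v)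
  hom (inj₁ x) (inj₁ y) x~y = f-hom x~y
  hom (inj₁ x) (inj₂ y) _   = tt
  hom (inj₂ x) (inj₁ y) _   = tt
  hom (inj₂ x) (inj₂ y) x~y = g-hom x~y

Complete : (X : Graph) {I : Set} → (I → V X) → Set
Complete X f = ∀ i j → i ≢ j → _~_ X (f i) (f j)

complete-∘ : (X : Graph) {I J : Set} {f : I → V X} {g : J → I} →
  Injective _≡_ _≡_ g → Complete X f → Complete X (f ∘ g)
complete-∘ X g-injective f-complete i j i≢j = f-complete _ _ (i≢j ∘ g-injective)

complete-⊎ : (X : Graph) {I J : Set} {f : I → V X} {g : J → V X} →
  Complete X f → Complete X g → (∀ i j → _~_ X (f i) (g j)) → Complete X [ f , g ]
complete-⊎ X f-complete g-complete f~g (inj₁ i) (inj₁ j) i≢j = f-complete i j (i≢j ∘ cong inj₁)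
complete-⊎ X f-complete g-complete f~g (inj₁ i) (inj₂ j) _   = f~g i j
complete-⊎ X f-complete g-complete f~g (inj₂ i) (inj₁ j) _   = sym~ X (f~g j i)
complete-⊎ X f-complete g-complete f~g (inj₂ i) (inj₂ j) i≢j = g-complete i j (i≢j ∘ cong inj₂)

complete-× : (X Y : Graph) {I J : Set} {f : I → V X} {g : J → V Y} → DecidableEquality I →
  Complete X f → Complete Y g → Complete (X ⊛ Y) (Product.map f g)
complete-× X Y _≟_ f-complete g-complete (i , j) (i′ , j′) ij≢i′j′ with i ≟ i′
... | no i≢i′  = inj₁ (f-complete i i′ i≢i′)
... | yes refl = inj₂ (g-complete j j′ (ij≢i′j′ ∘ cong (i ,_)))

singleton : (X : Graph) → V X → Clique X 1
singleton X x = (λ _ → x) , λ { zero zero 0≢0 → ⊥-elim (0≢0 refl) }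

mapClique : (X Y : Graph) → X ⇒ Y → ∀ {d} → Clique X d → Clique Y d
mapClique X Y (f , f-hom) (c , c-complete) = f ∘ c , λ i j i≢j → f-hom (c-complete i j i≢j)

concatClique : (X : Graph) {a b : ℕ} (c₁ : Clique X a) (c₂ : Clique X b) →
  (∀ i j → _~_ X (proj₁ c₁ i) (proj₁ c₂ j)) → Clique X (a + b)
concatClique X {a} (c₁ , c₁-complete) (c₂ , c₂-complete) c₁~c₂ =
  [ c₁ , c₂ ] ∘ splitAt a ,
  complete-∘ X (Injection.injective (↔⇒↣ Fin.+↔⊎)) (complete-⊎ X c₁-complete c₂-complete c₁~c₂)

productClique : (X Y : Graph) {d k : ℕ} → Clique X d → Clique Y k → Clique (X ⊛ Y) (d * k)
productClique X Y {d} {k} (c₁ , c₁-complete) (c₂ , c₂-complete) =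
  Product.map c₁ c₂ ∘ remQuot k ,
  complete-∘ (X ⊛ Y) (Injection.injective (↔⇒↣ (Fin.*↔× {d} {k})))
    (complete-× X Y Fin._≟_ c₁-complete c₂-complete)

⊕-clique : (G H : Graph) {a b : ℕ} → Clique G a → Clique H b → Clique (G ⊕ H) (a + b)
⊕-clique G H c₁ c₂ = concatClique (G ⊕ H)
  (mapClique G (G ⊕ H) (ι₁ G H) c₁) (mapClique H (G ⊕ H) (ι₂ G H) c₂) (λ _ _ → tt)

allAdjacent⇒cliqueAdj : (X : Graph) {d : ℕ} (S T : Clique X d) →
  (∀ i j → _~_ X (proj₁ S i) (proj₁ T j)) → cliqueAdj X d S T
allAdjacent⇒cliqueAdj X S T S~T = (λ i j → adj⇒≢ X (S~T i j)) , S~T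

/-map : (X Y : Graph) → X ⇒ Y → (d : ℕ) .{{_ : NonZero d}} → (X / d) ⇒ (Y / d)
/-map X Y f d = mapClique X Y f , λ {S} {T} S~T →
  allAdjacent⇒cliqueAdj Y (mapClique X Y f S) (mapClique X Y f T) (λ i j → proj₂ f (proj₂ S~T i j))

/-cast : (X : Graph) {d d′ : ℕ} .{{_ : NonZero d}} .{{_ : NonZero d′}} → d ≡ d′ → (X / d) ⇒ (X / d′)
/-cast X refl = (λ S → S) , λ S~T → S~T

⇒/1 : (X : Graph) → X ⇒ (X / 1)
⇒/1 X = singleton X , λ {x} {y} x~y → allAdjacent⇒cliqueAdj X (singleton X x) (singleton X y) (λ _ _ → x~y)

/1⇒ : (X : Graph) → (X / 1) ⇒ X
/1⇒ X = (λ S → proj₁ S zero) , λ S~T → proj₂ S~T zero zero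

⊕-/ : (X Y : Graph) (d : ℕ) .{{_ : NonZero d}} → ((X / d) ⊕ (Y / d)) ⇒ ((X ⊕ Y) / d)
⊕-/ X Y d = h , λ {u} {v} u~v → allAdjacent⇒cliqueAdj (X ⊕ Y) (h u) (h v) (allAdjacent u v u~v)
  where
  h : Clique X d ⊎ Clique Y d → Clique (X ⊕ Y) d
  h = [ mapClique X (X ⊕ Y) (ι₁ X Y) , mapClique Y (X ⊕ Y) (ι₂ X Y) ]
  allAdjacent : ∀ u v → joinAdj (X / d) (Y / d) u v →
    ∀ i j → joinAdj X Y (proj₁ (h u) i) (proj₁ (h v) j)
  allAdjacent (inj₁ S) (inj₁ T) S~T = proj₂ S~T
  allAdjacent (inj₁ S) (inj₂ T) _   = λ _ _ → tt
  allAdjacent (inj₂ S) (inj₁ T) _   = λ _ _ → tt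
  allAdjacent (inj₂ S) (inj₂ T) S~T = proj₂ S~T

/-scale : (X Y : Graph) {d k : ℕ} .{{_ : NonZero d}} .{{_ : NonZero (d * k)}} →
  Clique Y k → (X / d) ⇒ ((X ⊛ Y) / (d * k))
/-scale X Y c = (λ S → productClique X Y S c) , λ {S} {T} S~T →
  allAdjacent⇒cliqueAdj (X ⊛ Y) (productClique X Y S c) (productClique X Y T c)
    (λ i j → inj₁ (proj₂ S~T _ _))

corestrict/ : (Z X : Graph) (P : Subset X) {d : ℕ} .{{_ : NonZero d}} (f : Z ⇒ (X / d)) →
  (∀ z i → P (proj₁ (proj₁ f z) i)) → Z ⇒ (Induced X P / d)
corestrict/ Z X P {d} (f , f-hom) f∈P = h , λ {z} {z′} z~z′ →
  allAdjacent⇒cliqueAdj (Induced X P) (h z) (h z′) (proj₂ (f-hom z~z′))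
  where
  h : V Z → Clique (Induced X P) d
  h z = (λ i → proj₁ (f z) i , f∈P z i) , proj₂ (f z)

⊆-perp-perp : (X : Graph) (S : Subset X) {v : V X} → S v → perp X (perp X S) v
⊆-perp-perp X S v∈S t t∈S⊥ = sym~ X (t∈S⊥ _ v∈S)

perp-isFlat : (X : Graph) (S : Subset X) → IsFlat X (perp X S)
perp-isFlat X S v =
  (λ v∈S⊥⊥⊥ s s∈S → v∈S⊥⊥⊥ s (⊆-perp-perp X S s∈S)) , ⊆-perp-perp X (perp X S)

cliqueIn-⊆ : (X : Graph) {S T : Subset X} {k : ℕ} → (∀ {v} → S v → T v) → CliqueIn X S k → CliqueIn X T k
cliqueIn-⊆ X S⊆T (c , c∈S) = c , S⊆T ∘ c∈S

module _ (G H X : Graph) {d : ℕ} .{{_ : NonZero d}} (f : (G ⊕ H) ⇒ (X / d)) where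

  imageˡ : Subset X
  imageˡ v = Σ (V G) λ x → Σ (Fin d) λ i → proj₁ (proj₁ f (inj₁ x)) i ≡ v

  ⊕⇒/-splitˡ : G ⇒ (Induced X (perp X (perp X imageˡ)) / d)
  ⊕⇒/-splitˡ = corestrict/ G X (perp X (perp X imageˡ))
    (begin G ⇒⟨ ι₁ G H ⟩ G ⊕ H ⇒⟨ f ⟩ X / d ∎)
    (λ x i → ⊆-perp-perp X imageˡ (x , i , refl))

  ⊕⇒/-splitʳ : H ⇒ (Induced X (perp X imageˡ) / d)
  ⊕⇒/-splitʳ = corestrict/ H X (perp X imageˡ)
    (begin H ⇒⟨ ι₂ G H ⟩ G ⊕ H ⇒⟨ f ⟩ X / d ∎)
    λ { y i _ (x , j , refl) → proj₂ (proj₂ f {inj₁ x} {inj₂ y} tt) j i }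

module _ {F : ℕ → Graph} (F-semiring : SemiringFamily F) (F-linear : LinearLike F) where

  open SemiringFamily F-semiring

  flatRank : ∀ {m} (A : Subset (F m)) → IsFlat (F m) A →
    Σ ℕ λ r → CliqueIn (F m) A r × (∀ k → CliqueIn (F m) A k → k ≤ r) × (Induced (F m) A ≃ₕ F r)
  flatRank {m} A A-flat =
    let (r , (c , c-max) , A≃F[r]) = F-linear m A A-flat
    in r , cliqueIn-⊆ (F m) (λ {v} → proj₁ (A-flat v)) c
         , (λ k c′ → c-max k (cliqueIn-⊆ (F m) (λ {v} → proj₂ (A-flat v)) c′)) , A≃F[r]

  +-clique : ∀ {n m a b} → Clique (F n) a → Clique (F m) b → Clique (F (n + m)) (a + b)
  +-clique {n} {m} c₁ c₂ = mapClique (F n ⊕ F m) (F (n + m)) (addHom n m) (⊕-clique (F n) (F m) c₁ c₂)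

  n-clique : ∀ n → Clique (F n) n
  n-clique 0       = (λ ()) , λ ()
  n-clique (suc n) = +-clique {1} (singleton (F 1) inhab1) (n-clique n)

  -- ∅⊥ is the whole vertex set. For N = ω(F m) ≥ m, the graph F N = F (m + (N ∸ m)) has a
  -- clique of size N + (N ∸ m), which F N → F m carries into F m; hence N ≤ m.
  cliqueSize≤ : ∀ {m k} → Clique (F m) k → k ≤ m
  cliqueSize≤ {m} c with flatRank (perp (F m) ∅) (perp-isFlat (F m) ∅)
  ... | N , (maxClique , _) , N-max , (_ , F[N]⇒everything) = ℕ.≤-trans (bounded c) N≤m
    where
    bounded : ∀ {k} → Clique (F m) k → k ≤ N
    bounded c = N-max _ (c , λ _ _ ())
    F[N]⇒F[m] : F N ⇒ F m
    F[N]⇒F[m] = begin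
      F N                           ⇒⟨ F[N]⇒everything ⟩
      Induced (F m) (perp (F m) ∅)  ⇒⟨ proj₁ , (λ x~y → x~y) ⟩
      F m                           ∎
    excess : Clique (F m) (N + (N ∸ m))
    excess = mapClique (F N) (F m) F[N]⇒F[m]
      (subst (λ n → Clique (F n) (N + (N ∸ m))) (ℕ.m+[n∸m]≡n (bounded (n-clique m)))
        (+-clique maxClique (n-clique (N ∸ m))))
    N≤m : N ≤ m
    N≤m = ℕ.≮⇒≥ λ m<N → ℕ.<⇒≱ (ℕ.m<m+n N (ℕ.m<n⇒0<n∸m m<N)) (bounded excess)

  perpRanks : ∀ {m} (S : Subset (F m)) →
    Σ ℕ λ r₁ → Σ ℕ λ r₂ → r₁ + r₂ ≤ m
      × (Induced (F m) (perp (F m) (perp (F m) S)) ⇒ F r₁) × (Induced (F m) (perp (F m) S) ⇒ F r₂)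
  perpRanks {m} S =
    let (r₁ , (c₁ , c₁∈S⊥⊥) , _ , (S⊥⊥⇒F[r₁] , _)) = flatRank S⊥⊥ (perp-isFlat (F m) S⊥)
        (r₂ , (c₂ , c₂∈S⊥)  , _ , (S⊥⇒F[r₂] , _))  = flatRank S⊥ (perp-isFlat (F m) S)
    in r₁ , r₂
     , cliqueSize≤ (concatClique (F m) c₁ c₂ (λ i j → sym~ (F m) (c₁∈S⊥⊥ i _ (c₂∈S⊥ j))))
     , S⊥⊥⇒F[r₁] , S⊥⇒F[r₂]
    where
    S⊥ = perp (F m) S
    S⊥⊥ = perp (F m) S⊥

  ⊕⇒/-split : (G H : Graph) {m d : ℕ} .{{_ : NonZero d}} → (G ⊕ H) ⇒ (F m / d) →
    Σ ℕ λ r₁ → Σ ℕ λ r₂ → r₁ + r₂ ≤ m × (G ⇒ (F r₁ / d)) × (H ⇒ (F r₂ / d))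
  ⊕⇒/-split G H {m} {d} f =
    let (r₁ , r₂ , r₁+r₂≤m , S⊥⊥⇒F[r₁] , S⊥⇒F[r₂]) = perpRanks S
    in r₁ , r₂ , r₁+r₂≤m
     , (begin G                           ⇒⟨ ⊕⇒/-splitˡ G H (F m) f ⟩
              Induced (F m) S⊥⊥ / d       ⇒⟨ /-map (Induced (F m) S⊥⊥) (F r₁) S⊥⊥⇒F[r₁] d ⟩
              F r₁ / d                    ∎)
     , (begin H                           ⇒⟨ ⊕⇒/-splitʳ G H (F m) f ⟩
              Induced (F m) S⊥ / d        ⇒⟨ /-map (Induced (F m) S⊥) (F r₂) S⊥⇒F[r₂] d ⟩
              F r₂ / d                    ∎)
    where
    S = imageˡ G H (F m) f
    S⊥ = perp (F m) S
    S⊥⊥ = perp (F m) S⊥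

  η-⊕ : (G H : Graph) (a b : ℕ) → IsEta F G a → IsEta F H b → IsEta F (G ⊕ H) (a + b)
  η-⊕ G H a b (G⇒F[a] , a-min) (H⇒F[b] , b-min) =
    (begin G ⊕ H ⇒⟨ G⇒F[a] ⊕ₕ H⇒F[b] ⟩ F a ⊕ F b ⇒⟨ addHom a b ⟩ F (a + b) ∎) , a+b-min
    where
    a+b-min : ∀ m → (G ⊕ H) ⇒ F m → a + b ≤ m
    a+b-min m f =
      let (r₁ , r₂ , r₁+r₂≤m , g , h) =
            ⊕⇒/-split G H (begin G ⊕ H ⇒⟨ f ⟩ F m ⇒⟨ ⇒/1 (F m) ⟩ F m / 1 ∎)
      in ℕ.≤-trans (ℕ.+-mono-≤ (a-min r₁ (begin G ⇒⟨ g ⟩ F r₁ / 1 ⇒⟨ /1⇒ (F r₁) ⟩ F r₁ ∎))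
                               (b-min r₂ (begin H ⇒⟨ h ⟩ F r₂ / 1 ⇒⟨ /1⇒ (F r₂) ⟩ F r₂ ∎)))
                   r₁+r₂≤m

  aboveFrac⇒aboveFracSum : (G H : Graph) (r : ℚ) → AboveFrac F (G ⊕ H) r → AboveFracSum F G H r
  aboveFrac⇒aboveFracSum G H r (q , (n , d , f , q≡n/d) , q<r) =
    let (n₁ , n₂ , n₁+n₂≤n , g , h) = ⊕⇒/-split G H f
    in + n₁ ℚ./ suc d , + n₂ ℚ./ suc d , (n₁ , d , g , refl) , (n₂ , d , h , refl)
     , ℚ.≤-<-trans (n/d+m/d≤k/d n₁ n₂ d n₁+n₂≤n) (subst (ℚ._< r) q≡n/d q<r)

  F/-scale : ∀ n d k → (F n / suc d) ⇒ (F (n * suc k) / (suc d * suc k))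
  F/-scale n d k = begin
    F n / suc d                          ⇒⟨ /-scale (F n) (F (suc k)) (n-clique (suc k)) ⟩
    (F n ⊛ F (suc k)) / (suc d * suc k)  ⇒⟨ /-map (F n ⊛ F (suc k)) (F (n * suc k))
                                                    (mulHom n (suc k)) (suc d * suc k) ⟩
    F (n * suc k) / (suc d * suc k)      ∎

  aboveFracSum⇒aboveFrac : (G H : Graph) (r : ℚ) → AboveFracSum F G H r → AboveFrac F (G ⊕ H) r
  aboveFracSum⇒aboveFrac G H r
    (q₁ , q₂ , (n₁ , d₁ , g , q₁≡n₁/d₁) , (n₂ , d₂ , h , q₂≡n₂/d₂) , q₁+q₂<r) =
    q₁ ℚ.+ q₂
    , (a + b , d₂ + d₁ * D₂ , hom
      , trans (cong₂ ℚ._+_ q₁≡n₁/d₁ q₂≡n₂/d₂) (n/c+m/d≡[nd+mc]/cd n₁ d₁ n₂ d₂))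
    , q₁+q₂<r
    where
    D₁ = suc d₁
    D₂ = suc d₂
    D = D₁ * D₂
    a = n₁ * D₂
    b = n₂ * D₁
    g′ : G ⇒ (F a / D)
    g′ = begin G ⇒⟨ g ⟩ F n₁ / D₁ ⇒⟨ F/-scale n₁ d₁ d₂ ⟩ F a / D ∎
    h′ : H ⇒ (F b / D)
    h′ = begin
      H                ⇒⟨ h ⟩
      F n₂ / D₂        ⇒⟨ F/-scale n₂ d₂ d₁ ⟩
      F b / (D₂ * D₁)  ⇒⟨ /-cast (F b) (ℕ.*-comm D₂ D₁) ⟩
      F b / D          ∎
    hom : (G ⊕ H) ⇒ (F (a + b) / D)
    hom = begin
      G ⊕ H                  ⇒⟨ g′ ⊕ₕ h′ ⟩
      (F a / D) ⊕ (F b / D)  ⇒⟨ ⊕-/ (F a) (F b) D ⟩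
      (F a ⊕ F b) / D        ⇒⟨ /-map (F a ⊕ F b) (F (a + b)) (addHom a b) D ⟩
      F (a + b) / D          ∎

proposition4p10 : (F : ℕ → Graph) → SemiringFamily F → LinearLike F →
    (G H : Graph) → Finite G → Finite H →
    ((a b : ℕ) → IsEta F G a → IsEta F H b → IsEta F (G ⊕ H) (a + b))
    × ((r : ℚ) → (AboveFrac F (G ⊕ H) r → AboveFracSum F G H r)
                × (AboveFracSum F G H r → AboveFrac F (G ⊕ H) r))
proposition4p10 F F-semiring F-linear G H _ _ =
  η-⊕ F-semiring F-linear G H ,
  λ r → aboveFrac⇒aboveFracSum F-semiring F-linear G H r
      , aboveFracSum⇒aboveFrac F-semiring F-linear G H r
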